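{- Let $F(x)=\frac{x}{1+x}$ and let $x\in[0,1]$ be a reduced fraction. If $x<1/2$ then $P(5,F(x))=0$; if $1/2<x<1$ then $P(5,F(x))=\frac{2x-1}{x+1}$. Consequently, together with the scaling $P(k+1,F(x))=P(k,x)/(1+x)$ for $k\ge5$, the degree distribution of $G_{F(x)}$ is determined by that of $G_x$.
   Context: Farey binary tree: $\ell_1=\{0/1,1/1\}$, $\ell_{n+1}$ = mediants $\frac{p+p'}{q+q'}$ of pairs $p/q<p'/q'$ adjacent in $\bigcup_{i\le n}\ell_i$; each reduced $p/q\in(0,1)$ is the mediant of a unique adjacent pair $p_1/q_1<p_2/q_2$ (its parents). Haros graphs: $G_0$ has two nodes joined by an edge. For ordered-node graphs $G$ ($v_1,\dots,v_a$) and $G'$ ($w_1,\dots,w_b$), $G\oplus G'$ has nodes $u_1,\dots,u_{a+b-1}$ obtained by identifying $v_a$ with $w_1$, keeping all edges, and adding an edge $u_1u_{a+b-1}$. $G_{0/1}=G_{1/1}=G_0$, $G_{p/q}=G_{p_1/q_1}\oplus G_{p_2/q_2}$ ($q+1$ nodes). Degree convention: the first and last nodes are identified into one boundary node whose degree is the sum of their degrees, giving $q$ nodes; $P(k,p/q)$ is the fraction of these $q$ nodes having degree $k$. -}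

module Defs where

open import Data.Nat as ℕ using (ℕ; zero; suc; _+_; _*_; _∸_; _≡ᵇ_; _<ᵇ_)
open import Data.Bool using (Bool; true; false; if_then_else_; _∨_)
open import Data.List using (List; []; _∷_; _++_; map; foldr; upTo)
open import Data.Product using (_×_; _,_; proj₁; proj₂)
open import Data.Integer as ℤ using (ℤ; +_; ∣_∣)
open import Data.Rational as ℚ using (ℚ; ↥_; ↧ₙ_)

-- An ordered-node graph: number of nodes a (nodes 0 , … , a-1 stand for
-- v₁ , … , v_a) together with its list of edges (pairs of node indices).
Graph : Set
Graph = ℕ × List (ℕ × ℕ)

G₀ : Graph
G₀ = 2 , ((0 , 1) ∷ [])

-- G ⊕ G' : identify the last node of G with the first node of G'
-- (node j of G' becomes node (a-1)+j), keep all edges, and add the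
-- edge between the first node u₁ (index 0) and the last node u_{a+b-1}
-- (index a+b-2).
_⊕_ : Graph → Graph → Graph
(a , E) ⊕ (b , E') =
  (a + b ∸ 1) ,
  (E ++ (map (λ e → (proj₁ e + (a ∸ 1)) , (proj₂ e + (a ∸ 1))) E'
     ++ ((0 , (a + b ∸ 2)) ∷ [])))

-- Descent in the Farey (Stern–Brocot) binary tree towards p/q, with
-- current adjacent pair a/b < c/d and their Haros graphs gl, gr.
-- When p/q equals the mediant (a+c)/(b+d), the pair (a/b, c/d) is the
-- parent pair of p/q and G_{p/q} = gl ⊕ gr.  The first argument is fuel.
descend : ℕ → (p q a b c d : ℕ) → Graph → Graph → Graph
descend zero    p q a b c d gl gr = G₀
descend (suc f) p q a b c d gl gr =
  if p * (b + d) ≡ᵇ q * (a + c) then gl ⊕ gr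
  else if p * (b + d) <ᵇ q * (a + c)
       then descend f p q a b (a + c) (b + d) gl (gl ⊕ gr)
       else descend f p q (a + c) (b + d) c d (gl ⊕ gr) gr

-- Haros graph G_{p/q} for a reduced fraction p/q ∈ [0,1]
-- (G_{0/1} = G_{1/1} = G₀); it has q+1 nodes 0 , … , q.
haros : ℕ → ℕ → Graph
haros p q =
  if (p ≡ᵇ 0) ∨ (q ℕ.≤ᵇ p) then G₀ else descend q p q 0 1 1 1 G₀ G₀

deg : List (ℕ × ℕ) → ℕ → ℕ
deg E i = foldr (λ e n → (if proj₁ e ≡ᵇ i then 1 else 0)
                       + (if proj₂ e ≡ᵇ i then 1 else 0) + n) 0 E

-- number of the q nodes (first and last node identified into a boundary
-- node with the summed degree; interior nodes 1 , … , q-1) of degree k.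
count : ℕ → (q : ℕ) → List (ℕ × ℕ) → ℕ
count k q E =
  (if deg E 0 + deg E q ≡ᵇ k then 1 else 0)
  + foldr (λ i n → (if deg E (suc i) ≡ᵇ k then 1 else 0) + n) 0
          (upTo (q ∸ 1))

-- P(k, y) for y = p/q ∈ [0,1] (ℚ is always in lowest terms, q = ↧ₙ y ≥ 1):
-- fraction of the q nodes of G_{p/q} having degree k.
P : ℕ → ℚ → ℚ
P k y = (+ count k (↧ₙ y) (proj₂ (haros ∣ ↥ y ∣ (↧ₙ y)))) ℚ./ (↧ₙ y)

-- F(x) = x/(1+x); for x = p/q ≥ 0 this is p/(p+q).
F : ℚ → ℚ
F x = (↥ x) ℚ./ (↧ₙ x + ∣ ↥ x ∣)

-- (2x-1)/(x+1) for x = p/q ≥ 0, i.e. (2p-q)/(p+q).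
rhs : ℚ → ℚ
rhs x = ((+ 2) ℤ.* ↥ x ℤ.- + (↧ₙ x)) ℚ./ (↧ₙ x + ∣ ↥ x ∣)

-- Write x = n/q, so that F(x) = n/Q with Q = q + n.  The graph G_{n/Q} is reached by descending
-- the Farey tree from 0/1 < 1/1, each step joining the Haros graphs of the current neighbours
-- A/B < C/D.  Along a descent towards a target below 1/2, G_{A/B} has 3A ∸ B interior nodes of
-- degree 5 (the triangle G_{1/2} has none).  The join adds a single interior node, of degree
-- deg_last G_{A/B} + deg_first G_{C/D}, which is 5 exactly when C/D = 1/2 and A ≥ 1; otherwise
-- BC − AD = 1 keeps 3A − B and 3C − D from having opposite signs, so the truncated excesses add
-- up to that of the mediant.  The boundary node of G_{n/Q} has degree 5 only for n/Q = 1/3.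
-- Hence G_{F(x)} has 3n ∸ Q = 2n ∸ q nodes of degree 5 out of Q.

module Submission where

open import Defs

module FareyArithmetic where
  open import Data.Nat
  open import Data.Nat.Properties
  open import Data.Product using (_×_; _,_)
  open import Data.Sum using (_⊎_; inj₁; inj₂)
  open import Data.Empty using (⊥)
  open import Relation.Nullary using (yes; no)
  open import Relation.Binary.PropositionalEquality
  open import Data.Nat.Tactic.RingSolver using (solve-∀)
  open import Algebra.Properties.CommutativeSemigroup *-commutativeSemigroup using (x∙yz≈y∙xz)

  [m∸n]+[o∸p]≡[m+o]∸[n+p] : ∀ {m n o p} → (n ≤ m × p ≤ o) ⊎ (m ≤ n × o ≤ p) →
                              (m ∸ n) + (o ∸ p) ≡ (m + o) ∸ (n + p)
  [m∸n]+[o∸p]≡[m+o]∸[n+p] {m} {n} {o} {p} (inj₁ (n≤m , p≤o)) = begin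
    (m ∸ n) + (o ∸ p)  ≡⟨ sym (+-∸-assoc (m ∸ n) p≤o) ⟩
    (m ∸ n + o) ∸ p    ≡⟨ cong (_∸ p) (sym (+-∸-comm o n≤m)) ⟩
    (m + o ∸ n) ∸ p    ≡⟨ ∸-+-assoc (m + o) n p ⟩
    (m + o) ∸ (n + p)  ∎
    where open ≡-Reasoning
  [m∸n]+[o∸p]≡[m+o]∸[n+p] (inj₂ (m≤n , o≤p))
    rewrite m≤n⇒m∸n≡0 m≤n | m≤n⇒m∸n≡0 o≤p = sym (m≤n⇒m∸n≡0 (+-mono-≤ m≤n o≤p))

  module _ {A B C D : ℕ} (neighbours : B * C ≡ suc (A * D)) where
    open ≤-Reasoning

    excess-deficit-impossible : B < 3 * A → 3 * C < D → ⊥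
    excess-deficit-impossible B<3A 3C<D = <-irrefl refl (begin-strict
      3 * (A * D)      <⟨ *-monoʳ-< 3 (n<1+n (A * D)) ⟩
      3 * suc (A * D)  ≡⟨ cong (3 *_) neighbours ⟨
      3 * (B * C)      ≡⟨ x∙yz≈y∙xz 3 B C ⟩
      B * (3 * C)      <⟨ *-mono-< B<3A 3C<D ⟩
      3 * A * D        ≡⟨ *-assoc 3 A D ⟩
      3 * (A * D)      ∎)

    deficit-excess-impossible : 3 ≤ D → 3 * A < B → D < 3 * C → ⊥
    deficit-excess-impossible 3≤D 3A<B D<3C = <-irrefl refl (begin-strict
      3 * suc (A * D)                 ≡⟨ expand A D ⟩
      3 * (A * D) + 3                 <⟨ +-monoʳ-< (3 * (A * D)) (s≤s 3≤D) ⟩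
      3 * (A * D) + suc D             ≤⟨ m≤m+n _ (3 * A) ⟩
      3 * (A * D) + suc D + 3 * A     ≡⟨ factor A D ⟩
      suc (3 * A) * suc D             ≤⟨ *-mono-≤ 3A<B D<3C ⟩
      B * (3 * C)                     ≡⟨ x∙yz≈y∙xz B 3 C ⟩
      3 * (B * C)                     ≡⟨ cong (3 *_) neighbours ⟩
      3 * suc (A * D)                 ∎)
      where
      expand : ∀ A D → 3 * suc (A * D) ≡ 3 * (A * D) + 3
      expand = solve-∀
      factor : ∀ A D → 3 * (A * D) + suc D + 3 * A ≡ suc (3 * A) * suc D
      factor = solve-∀

    excess-signs-agree : 3 ≤ D → (B ≤ 3 * A × D ≤ 3 * C) ⊎ (3 * A ≤ B × 3 * C ≤ D)
    excess-signs-agree 3≤D with B ≤? 3 * A | D ≤? 3 * C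
    ... | yes B≤3A | yes D≤3C = inj₁ (B≤3A , D≤3C)
    ... | no  B≰3A | no  D≰3C = inj₂ (<⇒≤ (≰⇒> B≰3A) , <⇒≤ (≰⇒> D≰3C))
    ... | yes _    | no  D≰3C =
      inj₂ (≮⇒≥ (λ B<3A → excess-deficit-impossible B<3A (≰⇒> D≰3C)) , <⇒≤ (≰⇒> D≰3C))
    ... | no  B≰3A | yes _    =
      inj₂ (<⇒≤ (≰⇒> B≰3A) , ≮⇒≥ (λ D<3C → deficit-excess-impossible 3≤D (≰⇒> B≰3A) D<3C))

    mediant-excess : 3 ≤ D → (3 * A ∸ B) + (3 * C ∸ D) ≡ 3 * (A + C) ∸ (B + D)
    mediant-excess 3≤D = trans ([m∸n]+[o∸p]≡[m+o]∸[n+p] (excess-signs-agree 3≤D))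
                               (cong (_∸ (B + D)) (sym (*-distribˡ-+ 3 A C)))

    0<C : 0 < C
    0<C = n≢0⇒n>0 λ C≡0 → 0≢1+n (begin-equality
      0            ≡⟨ *-zeroʳ B ⟨
      B * 0        ≡⟨ cong (B *_) C≡0 ⟨
      B * C        ≡⟨ neighbours ⟩
      suc (A * D)  ∎)

    weights-mediant : ∀ α β → (α * A + β * C) * (B + D) + α ≡ (α * B + β * D) * (A + C) + β
    weights-mediant α β = begin-equality
      (α * A + β * C) * (B + D) + α                              ≡⟨ expand α β A B C D ⟩
      α * A * B + α * A * D + β * (B * C) + β * C * D + α        ≡⟨ cong (λ n → α * A * B + α * A * D + β * n + β * C * D + α) neighbours ⟩
      α * A * B + α * A * D + β * suc (A * D) + β * C * D + α    ≡⟨ exchange α β A B C D ⟩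
      α * A * B + α * suc (A * D) + β * A * D + β * C * D + β    ≡⟨ cong (λ n → α * A * B + α * n + β * A * D + β * C * D + β) neighbours ⟨
      α * A * B + α * (B * C) + β * A * D + β * C * D + β        ≡⟨ factor α β A B C D ⟩
      (α * B + β * D) * (A + C) + β                              ∎
      where
      expand : ∀ α β A B C D → (α * A + β * C) * (B + D) + α ≡ α * A * B + α * A * D + β * (B * C) + β * C * D + α
      expand = solve-∀
      exchange : ∀ α β A B C D → α * A * B + α * A * D + β * suc (A * D) + β * C * D + α
                                 ≡ α * A * B + α * suc (A * D) + β * A * D + β * C * D + β
      exchange = solve-∀
      factor : ∀ α β A B C D → α * A * B + α * (B * C) + β * A * D + β * C * D + β ≡ (α * B + β * D) * (A + C) + β
      factor = solve-∀

module HarosGraphs where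
  open import Data.Nat
  open import Data.Nat.Properties
  open import Data.Bool using (Bool; true; false; if_then_else_)
  open import Data.List using (List; []; _∷_; _++_; map; foldr; applyUpTo)
  open import Data.List.Relation.Unary.All using (All; []; _∷_) renaming (map to All-map)
  open import Data.List.Relation.Unary.All.Properties using (++⁺; map⁺)
  open import Data.Product using (_×_; _,_; proj₁; proj₂)
  open import Function using (_∘_)
  open import Relation.Binary.PropositionalEquality
  open import Relation.Nullary using (¬_)
  open import Relation.Nullary.Decidable using (dec-true; dec-false)
  open import Algebra.Properties.CommutativeSemigroup +-commutativeSemigroup using (x∙yz≈xz∙y)

  Edges : Set
  Edges = List (ℕ × ℕ)

  indicator : Bool → ℕ
  indicator b = if b then 1 else 0

  ≡ᵇ-true : ∀ {m n} → m ≡ n → (m ≡ᵇ n) ≡ true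
  ≡ᵇ-true {m} {n} = dec-true (m ≟ n)

  ≡ᵇ-false : ∀ {m n} → m ≢ n → (m ≡ᵇ n) ≡ false
  ≡ᵇ-false {m} {n} = dec-false (m ≟ n)

  ≤ᵇ-false : ∀ {m n} → ¬ m ≤ n → (m ≤ᵇ n) ≡ false
  ≤ᵇ-false {m} {n} = dec-false (m ≤? n)

  <ᵇ-true : ∀ {m n} → m < n → (m <ᵇ n) ≡ true
  <ᵇ-true {m} {n} = dec-true (m <? n)

  <ᵇ-false : ∀ {m n} → ¬ m < n → (m <ᵇ n) ≡ false
  <ᵇ-false {m} {n} = dec-false (m <? n)

  +-cancelʳ-≡ᵇ : ∀ m n o → (m + o ≡ᵇ n + o) ≡ (m ≡ᵇ n)
  +-cancelʳ-≡ᵇ m n zero rewrite +-identityʳ m | +-identityʳ n = refl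
  +-cancelʳ-≡ᵇ m n (suc o) rewrite +-suc m o | +-suc n o = +-cancelʳ-≡ᵇ m n o

  NodesBelow : ℕ → Edges → Set
  NodesBelow n = All (λ e → proj₁ e < n × proj₂ e < n)

  shift : ℕ → ℕ × ℕ → ℕ × ℕ
  shift s (i , j) = i + s , j + s

  deg-++ : ∀ E E' i → deg (E ++ E') i ≡ deg E i + deg E' i
  deg-++ []      E' i = refl
  deg-++ (e ∷ E) E' i rewrite deg-++ E E' i = sym (+-assoc _ (deg E i) (deg E' i))

  deg-shift : ∀ s E i → deg (map (shift s) E) (i + s) ≡ deg E i
  deg-shift s []      i = refl
  deg-shift s (e ∷ E) i
    rewrite +-cancelʳ-≡ᵇ (proj₁ e) i s | +-cancelʳ-≡ᵇ (proj₂ e) i s | deg-shift s E i = refl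

  +-≢-< : ∀ x {s i} → i < s → x + s ≢ i
  +-≢-< x {s} i<s eq = <⇒≱ i<s (subst (s ≤_) eq (m≤n+m s x))

  deg-shift-< : ∀ s E {i} → i < s → deg (map (shift s) E) i ≡ 0
  deg-shift-< s []      i<s = refl
  deg-shift-< s (e ∷ E) {i} i<s
    rewrite ≡ᵇ-false (+-≢-< (proj₁ e) i<s) | ≡ᵇ-false (+-≢-< (proj₂ e) i<s) = deg-shift-< s E i<s

  deg-≥ : ∀ {n} E {i} → NodesBelow n E → n ≤ i → deg E i ≡ 0
  deg-≥ []      []                   n≤i = refl
  deg-≥ (e ∷ E) ((e₁<n , e₂<n) ∷ E<n) n≤i
    rewrite ≡ᵇ-false (<⇒≢ (<-≤-trans e₁<n n≤i)) | ≡ᵇ-false (<⇒≢ (<-≤-trans e₂<n n≤i)) = deg-≥ E E<n n≤i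

  sumBelow : ℕ → (ℕ → ℕ) → ℕ
  sumBelow zero    h = 0
  sumBelow (suc m) h = h 0 + sumBelow m (h ∘ suc)

  sumBelow-cong : ∀ m {h h'} → (∀ {i} → i < m → h i ≡ h' i) → sumBelow m h ≡ sumBelow m h'
  sumBelow-cong zero    h≗h' = refl
  sumBelow-cong (suc m) h≗h' = cong₂ _+_ (h≗h' z<s) (sumBelow-cong m (h≗h' ∘ s<s))

  sumBelow-+ : ∀ m n h → sumBelow (m + n) h ≡ sumBelow m h + sumBelow n (h ∘ (m +_))
  sumBelow-+ zero    n h = refl
  sumBelow-+ (suc m) n h rewrite sumBelow-+ m n (h ∘ suc) = sym (+-assoc (h 0) _ _)

  foldr-applyUpTo : ∀ (g f : ℕ → ℕ) m → foldr (λ i n → g i + n) 0 (applyUpTo f m) ≡ sumBelow m (g ∘ f)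
  foldr-applyUpTo g f zero    = refl
  foldr-applyUpTo g f (suc m) = cong (g (f 0) +_) (foldr-applyUpTo g (f ∘ suc) m)

  interior : ℕ → Edges → ℕ → ℕ
  interior k E m = sumBelow m (λ i → indicator (deg E (suc i) ≡ᵇ k))

  count-interior : ∀ k q E → count k q E ≡ indicator (deg E 0 + deg E q ≡ᵇ k) + interior k E (q ∸ 1)
  count-interior k q E =
    cong (indicator (deg E 0 + deg E q ≡ᵇ k) +_)
         (foldr-applyUpTo (λ i → indicator (deg E (suc i) ≡ᵇ k)) (λ i → i) (q ∸ 1))

  joinEdges : ℕ → ℕ → Edges → Edges → Edges
  joinEdges B D E E' = E ++ map (shift B) E' ++ (0 , B + D) ∷ []

  ⊕-joinEdges : ∀ B D E E' → (suc B , E) ⊕ (suc D , E') ≡ (suc (B + D) , joinEdges B D E E')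
  ⊕-joinEdges B D E E' rewrite +-suc B D = refl

  joinEdges-nodesBelow : ∀ B D {E E'} → NodesBelow (suc B) E → NodesBelow (suc D) E' →
                         NodesBelow (suc (B + D)) (joinEdges B D E E')
  joinEdges-nodesBelow B D E<B E'<D =
    ++⁺ (All-map (λ (i<B , j<B) → weaken i<B , weaken j<B) E<B)
        (++⁺ (map⁺ (All-map (λ (i<D , j<D) → shifted i<D , shifted j<D) E'<D)) ((z<s , n<1+n (B + D)) ∷ []))
    where
    weaken : ∀ {x} → x < suc B → x < suc (B + D)
    weaken x<B = <-≤-trans x<B (s≤s (m≤m+n B D))
    shifted : ∀ {x} → x < suc D → x + B < suc (B + D)
    shifted {x} x<D = subst (x + B <_) (cong suc (+-comm D B)) (+-monoˡ-< B x<D)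

  deg-joinEdges : ∀ B D E E' i → deg (joinEdges B D E E') i
                  ≡ deg E i + (deg (map (shift B) E') i + (indicator (0 ≡ᵇ i) + indicator (B + D ≡ᵇ i) + 0))
  deg-joinEdges B D E E' i rewrite deg-++ E (map (shift B) E' ++ (0 , B + D) ∷ []) i
                                 | deg-++ (map (shift B) E') ((0 , B + D) ∷ []) i = refl

  deg-join-first : ∀ b D E E' → deg (joinEdges (suc b) D E E') 0 ≡ deg E 0 + 1
  deg-join-first b D E E' rewrite deg-joinEdges (suc b) D E E' 0 | deg-shift-< (suc b) E' z<s = refl

  deg-join-last : ∀ B d {E} E' → NodesBelow (suc B) E →
                  deg (joinEdges B (suc d) E E') (B + suc d) ≡ deg E' (suc d) + 1
  deg-join-last B d {E} E' E<B
    rewrite deg-joinEdges B (suc d) E E' (B + suc d) | deg-≥ E E<B (m<m+n B (z<s {d}))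
          | +-comm B (suc d) | deg-shift B E' (suc d) | ≡ᵇ-true {suc d + B} refl = refl

  deg-join-left : ∀ B D E E' {i} → suc i < B → deg (joinEdges B D E E') (suc i) ≡ deg E (suc i)
  deg-join-left B D E E' {i} i<B
    rewrite deg-joinEdges B D E E' (suc i) | deg-shift-< B E' i<B
          | ≡ᵇ-false (<⇒≢ (<-≤-trans i<B (m≤m+n B D)) ∘ sym) = +-identityʳ (deg E (suc i))

  deg-join-junction : ∀ b d E E' → deg (joinEdges (suc b) (suc d) E E') (suc b) ≡ deg E (suc b) + deg E' 0
  deg-join-junction b d E E'
    rewrite deg-joinEdges (suc b) (suc d) E E' (suc b) | ≡ᵇ-false (<⇒≢ (m<m+n (suc b) (z<s {d})) ∘ sym) =
    cong (deg E (suc b) +_) (trans (+-identityʳ _) (deg-shift (suc b) E' 0))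

  deg-join-right : ∀ B D {E} E' {j} → NodesBelow (suc B) E → suc j < D →
                   deg (joinEdges B D E E') (B + suc j) ≡ deg E' (suc j)
  deg-join-right B D {E} E' {j} E<B j<D
    rewrite deg-joinEdges B D E E' (B + suc j) | deg-≥ E E<B (m<m+n B (z<s {j}))
          | ≡ᵇ-false (<⇒≢ (+-monoʳ-< B j<D) ∘ sym) | +-comm B (suc j) | deg-shift B E' (suc j) =
    +-identityʳ (deg E' (suc j))

  interior-join : ∀ k b d E E' → NodesBelow (suc (suc b)) E →
    interior k (joinEdges (suc b) (suc d) E E') (b + suc d)
    ≡ interior k E b + interior k E' d + indicator (deg E (suc b) + deg E' 0 ≡ᵇ k)
  interior-join k b d E E' E<B = begin
    sumBelow (b + suc d) h                                                  ≡⟨ sumBelow-+ b (suc d) h ⟩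
    sumBelow b h + (h (b + 0) + sumBelow d (λ j → h (b + suc j)))           ≡⟨ cong₂ _+_ left (cong₂ _+_ junction right) ⟩
    interior k E b + (junctionIs5 + interior k E' d)                        ≡⟨ x∙yz≈xz∙y (interior k E b) junctionIs5 (interior k E' d) ⟩
    interior k E b + interior k E' d + junctionIs5                          ∎
    where
    open ≡-Reasoning
    joined : Edges
    joined = joinEdges (suc b) (suc d) E E'
    h : ℕ → ℕ
    h i = indicator (deg joined (suc i) ≡ᵇ k)
    junctionIs5 : ℕ
    junctionIs5 = indicator (deg E (suc b) + deg E' 0 ≡ᵇ k)
    left : sumBelow b h ≡ interior k E b
    left = sumBelow-cong b (λ i<b → cong (λ n → indicator (n ≡ᵇ k)) (deg-join-left (suc b) (suc d) E E' (s<s i<b)))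
    junction : h (b + 0) ≡ junctionIs5
    junction rewrite +-identityʳ b = cong (λ n → indicator (n ≡ᵇ k)) (deg-join-junction b d E E')
    right : sumBelow d (λ j → h (b + suc j)) ≡ interior k E' d
    right = sumBelow-cong d (λ j<d → cong (λ n → indicator (n ≡ᵇ k)) (deg-join-right (suc b) (suc d) E' E<B (s<s j<d)))

  descend-at : ∀ f p q a b c d gl gr → p * (b + d) ≡ q * (a + c) →
               descend (suc f) p q a b c d gl gr ≡ gl ⊕ gr
  descend-at f p q a b c d gl gr eq rewrite ≡ᵇ-true eq = refl

  descend-below : ∀ f p q a b c d gl gr → p * (b + d) < q * (a + c) →
                  descend (suc f) p q a b c d gl gr ≡ descend f p q a b (a + c) (b + d) gl (gl ⊕ gr)
  descend-below f p q a b c d gl gr lt rewrite ≡ᵇ-false (<⇒≢ lt) | <ᵇ-true lt = refl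

  descend-above : ∀ f p q a b c d gl gr → q * (a + c) < p * (b + d) →
                  descend (suc f) p q a b c d gl gr ≡ descend f p q (a + c) (b + d) c d (gl ⊕ gr) gr
  descend-above f p q a b c d gl gr gt rewrite ≡ᵇ-false (>⇒≢ gt) | <ᵇ-false (<⇒≯ gt) = refl

  haros-first-step : ∀ p f → 0 < p → 2 * p < suc f →
                     haros p (suc f) ≡ descend f p (suc f) 0 1 1 2 G₀ (G₀ ⊕ G₀)
  haros-first-step (suc p) f _ 2p<Q
    rewrite ≤ᵇ-false (<⇒≱ (≤-<-trans (m≤n*m (suc p) 2) 2p<Q))
    = descend-below f (suc p) (suc f) 0 1 1 1 G₀ G₀ (subst₂ _<_ (*-comm 2 (suc p)) (sym (*-identityʳ (suc f))) 2p<Q)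

module Descent where
  open import Data.Nat
  open import Data.Nat.Properties
  open import Data.Nat.Coprimality using (Coprime)
  open import Data.Nat.Divisibility using (divides)
  open import Data.List using ([]; _∷_)
  open import Data.List.Relation.Unary.All using ([]; _∷_)
  open import Data.Product using (_×_; _,_; proj₁; proj₂)
  open import Data.Sum using (_⊎_; inj₁; inj₂)
  open import Data.Empty using (⊥-elim)
  open import Function using (_∘_)
  open import Relation.Binary.Definitions using (tri<; tri≈; tri>)
  open import Relation.Binary.PropositionalEquality
  open ≡-Reasoning
  open FareyArithmetic
  open HarosGraphs

  zero-or-pos : ∀ n → n ≡ 0 ⊎ 1 ≤ n
  zero-or-pos zero    = inj₁ refl
  zero-or-pos (suc n) = inj₂ (s≤s z≤n)

  two-or-more : ∀ {n} → 2 ≤ n → n ≡ 2 ⊎ 3 ≤ n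
  two-or-more {2}                 (s≤s (s≤s z≤n)) = inj₁ refl
  two-or-more {suc (suc (suc n))} _               = inj₂ (s≤s (s≤s (s≤s z≤n)))

  ∸-weights : ∀ {α β} x y → β ≤ α → (α ∸ β) * x + β * (x + y) ≡ α * x + β * y
  ∸-weights {α} {β} x y β≤α = begin
    (α ∸ β) * x + β * (x + y)      ≡⟨ cong ((α ∸ β) * x +_) (*-distribˡ-+ β x y) ⟩
    (α ∸ β) * x + (β * x + β * y)  ≡⟨ +-assoc ((α ∸ β) * x) (β * x) (β * y) ⟨
    (α ∸ β) * x + β * x + β * y    ≡⟨ cong (_+ β * y) (*-distribʳ-+ x (α ∸ β) β) ⟨
    (α ∸ β + β) * x + β * y        ≡⟨ cong (λ n → n * x + β * y) (m∸n+n≡m β≤α) ⟩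
    α * x + β * y                  ∎

  ∸-weights′ : ∀ {α β} x y → α ≤ β → α * (x + y) + (β ∸ α) * y ≡ α * x + β * y
  ∸-weights′ {α} {β} x y α≤β = begin
    α * (x + y) + (β ∸ α) * y  ≡⟨ +-comm (α * (x + y)) ((β ∸ α) * y) ⟩
    (β ∸ α) * y + α * (x + y)  ≡⟨ cong (λ n → (β ∸ α) * y + α * n) (+-comm x y) ⟩
    (β ∸ α) * y + α * (y + x)  ≡⟨ ∸-weights y x α≤β ⟩
    β * y + α * x              ≡⟨ +-comm (β * y) (α * x) ⟩
    α * x + β * y              ∎

  module Target (p Q : ℕ) (coprime : Coprime p Q) (3p≢Q : 3 * p ≢ Q) where

    -- p/Q = (αA + βC)/(αB + βD) with α, β ≥ 1; each step towards p/Q lowers α + β, so it bounds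
    -- the fuel the descent still needs.
    record Weights (f A B C D : ℕ) : Set where
      field
        α β  : ℕ
        1≤α  : 1 ≤ α
        1≤β  : 1 ≤ β
        Q≡   : α * B + β * D ≡ Q
        p≡   : α * A + β * C ≡ p
        fuel : α + β ≤ suc f

    module _ {f A B C D} (w : Weights f A B C D) where
      open Weights w

      weights-fuel≢0 : f ≢ 0
      weights-fuel≢0 refl = <⇒≱ (+-mono-≤ 1≤α 1≤β) fuel

      weights-at : α ≡ β → p ≡ A + C × Q ≡ B + D
      weights-at α≡β = trans (sym p≡) (collapse A C) , trans (sym Q≡) (collapse B D)
        where
        factor : ∀ X Y → α * X + β * Y ≡ (X + Y) * α
        factor X Y = begin
          α * X + β * Y  ≡⟨ cong (λ b → α * X + b * Y) α≡β ⟨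
          α * X + α * Y  ≡⟨ *-distribˡ-+ α X Y ⟨
          α * (X + Y)    ≡⟨ *-comm α (X + Y) ⟩
          (X + Y) * α    ∎
        α≡1 : α ≡ 1
        α≡1 = coprime (divides (A + C) (trans (sym p≡) (factor A C)) , divides (B + D) (trans (sym Q≡) (factor B D)))
        collapse : ∀ X Y → α * X + β * Y ≡ X + Y
        collapse X Y = trans (factor X Y) (trans (cong ((X + Y) *_) α≡1) (*-identityʳ (X + Y)))

      module _ (neighbours : B * C ≡ suc (A * D)) where

        weights-compare : p * (B + D) + α ≡ Q * (A + C) + β
        weights-compare = begin
          p * (B + D) + α                ≡⟨ cong (λ n → n * (B + D) + α) p≡ ⟨
          (α * A + β * C) * (B + D) + α  ≡⟨ weights-mediant neighbours α β ⟩
          (α * B + β * D) * (A + C) + β  ≡⟨ cong (λ n → n * (A + C) + β) Q≡ ⟩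
          Q * (A + C) + β                ∎

        at-mediant : α ≡ β → p * (B + D) ≡ Q * (A + C)
        at-mediant α≡β = +-cancelʳ-≡ α _ _ (trans weights-compare (cong (Q * (A + C) +_) (sym α≡β)))

        below-mediant : β < α → p * (B + D) < Q * (A + C)
        below-mediant β<α =
          +-cancelʳ-< β _ _ (<-≤-trans (+-monoʳ-< (p * (B + D)) β<α) (≤-reflexive weights-compare))

        above-mediant : α < β → Q * (A + C) < p * (B + D)
        above-mediant α<β =
          +-cancelʳ-< α _ _ (<-≤-trans (+-monoʳ-< (Q * (A + C)) α<β) (≤-reflexive (sym weights-compare)))

    weights-left : ∀ {f A B C D} (w : Weights (suc f) A B C D) → Weights.β w < Weights.α w →
                   Weights f A B (A + C) (B + D)
    weights-left {f} w β<α = record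
      { α = α ∸ β ; β = β ; 1≤α = m<n⇒0<n∸m β<α ; 1≤β = 1≤β
      ; Q≡ = trans (∸-weights _ _ (<⇒≤ β<α)) Q≡
      ; p≡ = trans (∸-weights _ _ (<⇒≤ β<α)) p≡
      ; fuel = subst (_≤ suc f) (sym (m∸n+n≡m (<⇒≤ β<α))) (≤-pred (<-≤-trans (m<m+n α 1≤β) fuel))
      }
      where open Weights w

    weights-right : ∀ {f A B C D} (w : Weights (suc f) A B C D) → Weights.α w < Weights.β w →
                    Weights f (A + C) (B + D) C D
    weights-right {f} w α<β = record
      { α = α ; β = β ∸ α ; 1≤α = 1≤α ; 1≤β = m<n⇒0<n∸m α<β
      ; Q≡ = trans (∸-weights′ _ _ (<⇒≤ α<β)) Q≡
      ; p≡ = trans (∸-weights′ _ _ (<⇒≤ α<β)) p≡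
      ; fuel = subst (_≤ suc f) (sym (m+[n∸m]≡n (<⇒≤ α<β))) (≤-pred (<-≤-trans (m<n+m β 1≤α) fuel))
      }
      where open Weights w

    -- E and E' are the edge lists of G_{A/B} and G_{C/D}, with last nodes B and D.
    record Invariant (f A B C D : ℕ) (E E' : Edges) : Set where
      field
        weights        : Weights f A B C D
        neighbours     : B * C ≡ suc (A * D)
        1≤B            : 1 ≤ B
        2≤D            : 2 ≤ D
        nodesL         : NodesBelow (suc B) E
        nodesR         : NodesBelow (suc D) E'
        left-zero      : A ≡ 0 → deg E B ≡ 1 × deg E 0 ≡ 1 × deg E' 0 ≡ 2
        left-pos       : 1 ≤ A → 3 ≤ deg E B × 2 ≤ deg E 0
        right-ends     : 2 ≤ deg E' D × 2 ≤ deg E' 0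
        right-half     : D ≡ 2 → deg E' 0 ≡ 2 × deg E' D ≡ 2 × C ≡ 1 × (1 ≤ A → deg E B ≡ 3 × B ≤ 3 * A)
        right-long     : 3 ≤ D → 3 ≤ deg E' D × (1 ≤ A → 6 ≤ deg E B + deg E' 0)
        interiorL      : interior 5 E (B ∸ 1) ≡ 3 * A ∸ B
        interiorR-half : D ≡ 2 → interior 5 E' (D ∸ 1) ≡ 0
        interiorR-long : 3 ≤ D → interior 5 E' (D ∸ 1) ≡ 3 * C ∸ D

    module Step {f A b C d E E'} (inv : Invariant (suc f) A (suc b) C (suc d) E E') where
      open Invariant inv

      joined : Edges
      joined = joinEdges (suc b) (suc d) E E'

      G-left G-right G-mediant : Graph
      G-left    = suc (suc b) , E
      G-right   = suc (suc d) , E'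
      G-mediant = suc (suc b + suc d) , joined

      ⊕-mediant : G-left ⊕ G-right ≡ G-mediant
      ⊕-mediant = ⊕-joinEdges (suc b) (suc d) E E'

      first : deg joined 0 ≡ deg E 0 + 1
      first = deg-join-first b (suc d) E E'

      last : deg joined (suc b + suc d) ≡ deg E' (suc d) + 1
      last = deg-join-last (suc b) d E' nodesL

      1≤first : 1 ≤ deg E 0
      1≤first with zero-or-pos A
      ... | inj₁ A≡0 = ≤-reflexive (sym (proj₁ (proj₂ (left-zero A≡0))))
      ... | inj₂ 1≤A = ≤-trans (s≤s z≤n) (proj₂ (left-pos 1≤A))

      3≤B+D : 3 ≤ suc b + suc d
      3≤B+D = +-mono-≤ 1≤B 2≤D

      unimodular-at-zero : A ≡ 0 → suc b * C ≡ 1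
      unimodular-at-zero A≡0 = trans neighbours (cong (λ a → suc (a * suc d)) A≡0)

      half-3[A+C] : suc d ≡ 2 → 3 * A + 3 ≡ 3 * (A + C)
      half-3[A+C] D≡2 = trans (sym (*-distribˡ-+ 3 A 1))
                              (cong (λ c → 3 * (A + c)) (sym (proj₁ (proj₂ (proj₂ (right-half D≡2))))))

      junction5 : ℕ
      junction5 = indicator (deg E (suc b) + deg E' 0 ≡ᵇ 5)

      interiors-from-zero : A ≡ 0 → suc d ≡ 2 ⊎ 3 ≤ suc d →
                            interior 5 E b + interior 5 E' d + junction5 ≡ 3 * (A + C) ∸ (suc b + suc d)
      interiors-from-zero A≡0 D-cases = begin
        interior 5 E b + interior 5 E' d + junction5  ≡⟨ cong₂ _+_ (cong₂ _+_ left (right D-cases)) junction ⟩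
        0                                             ≡⟨ m≤n⇒m∸n≡0 (subst (_≤ suc b + suc d) (sym 3[A+C]≡3) 3≤B+D) ⟨
        3 * (A + C) ∸ (suc b + suc d)                 ∎
        where
        C≡1 : C ≡ 1
        C≡1 = m*n≡1⇒n≡1 (suc b) C (unimodular-at-zero A≡0)
        3[A+C]≡3 : 3 * (A + C) ≡ 3
        3[A+C]≡3 = cong (3 *_) (cong₂ _+_ A≡0 C≡1)
        left : interior 5 E b ≡ 0
        left = trans interiorL (cong (λ a → 3 * a ∸ suc b) A≡0)
        right : suc d ≡ 2 ⊎ 3 ≤ suc d → interior 5 E' d ≡ 0
        right (inj₁ D≡2) = interiorR-half D≡2
        right (inj₂ 3≤D) = trans (interiorR-long 3≤D) (m≤n⇒m∸n≡0 (subst (_≤ suc d) (sym (cong (3 *_) C≡1)) 3≤D))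
        junction : junction5 ≡ 0
        junction = cong (λ n → indicator (n ≡ᵇ 5)) (cong₂ _+_ (proj₁ (left-zero A≡0)) (proj₂ (proj₂ (left-zero A≡0))))

      interiors-at-half : 1 ≤ A → suc d ≡ 2 →
                          interior 5 E b + interior 5 E' d + junction5 ≡ 3 * (A + C) ∸ (suc b + suc d)
      interiors-at-half 1≤A D≡2 = begin
        interior 5 E b + interior 5 E' d + junction5  ≡⟨ cong₂ _+_ (cong₂ _+_ interiorL (interiorR-half D≡2)) junction ⟩
        3 * A ∸ suc b + 0 + 1                         ≡⟨ cong (_+ 1) (+-identityʳ (3 * A ∸ suc b)) ⟩
        (3 * A ∸ suc b) + (3 ∸ 2)                     ≡⟨ [m∸n]+[o∸p]≡[m+o]∸[n+p] (inj₁ (B≤3A , s≤s (s≤s z≤n))) ⟩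
        (3 * A + 3) ∸ (suc b + 2)                     ≡⟨ cong₂ _∸_ (half-3[A+C] D≡2) (cong (suc b +_) (sym D≡2)) ⟩
        3 * (A + C) ∸ (suc b + suc d)                 ∎
        where
        half = right-half D≡2
        B≤3A : suc b ≤ 3 * A
        B≤3A = proj₂ (proj₂ (proj₂ (proj₂ half)) 1≤A)
        junction : junction5 ≡ 1
        junction = cong (λ n → indicator (n ≡ᵇ 5)) (cong₂ _+_ (proj₁ (proj₂ (proj₂ (proj₂ half)) 1≤A)) (proj₁ half))

      interiors-long : 1 ≤ A → 3 ≤ suc d →
                       interior 5 E b + interior 5 E' d + junction5 ≡ 3 * (A + C) ∸ (suc b + suc d)
      interiors-long 1≤A 3≤D = begin
        interior 5 E b + interior 5 E' d + junction5  ≡⟨ cong₂ _+_ (cong₂ _+_ interiorL (interiorR-long 3≤D)) junction ⟩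
        (3 * A ∸ suc b) + (3 * C ∸ suc d) + 0         ≡⟨ +-identityʳ _ ⟩
        (3 * A ∸ suc b) + (3 * C ∸ suc d)             ≡⟨ mediant-excess {A} {suc b} {C} {suc d} neighbours 3≤D ⟩
        3 * (A + C) ∸ (suc b + suc d)                 ∎
        where
        junction : junction5 ≡ 0
        junction = cong indicator (≡ᵇ-false (>⇒≢ (proj₂ (right-long 3≤D) 1≤A)))

      interior-mediant : interior 5 joined (b + suc d) ≡ 3 * (A + C) ∸ (suc b + suc d)
      interior-mediant = trans (interior-join 5 b d E E' nodesL) interiors
        where
        interiors : interior 5 E b + interior 5 E' d + junction5 ≡ 3 * (A + C) ∸ (suc b + suc d)
        interiors with zero-or-pos A | two-or-more 2≤D
        ... | inj₁ A≡0 | D-cases  = interiors-from-zero A≡0 D-cases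
        ... | inj₂ 1≤A | inj₁ D≡2 = interiors-at-half 1≤A D≡2
        ... | inj₂ 1≤A | inj₂ 3≤D = interiors-long 1≤A 3≤D

      step-left : Weights.β weights < Weights.α weights →
                  Invariant f A (suc b) (A + C) (suc b + suc d) E joined
      step-left β<α = record
        { weights        = weights-left weights β<α
        ; neighbours     = left-neighbours
        ; 1≤B            = 1≤B
        ; 2≤D            = ≤-trans 2≤D (m≤n+m (suc d) (suc b))
        ; nodesL         = nodesL
        ; nodesR         = joinEdges-nodesBelow (suc b) (suc d) nodesL nodesR
        ; left-zero      = λ A≡0 → proj₁ (left-zero A≡0) , proj₁ (proj₂ (left-zero A≡0)) ,
                                   trans first (cong (_+ 1) (proj₁ (proj₂ (left-zero A≡0))))
        ; left-pos       = left-pos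
        ; right-ends     = 2≤last , subst (2 ≤_) (sym first) (+-monoˡ-≤ 1 1≤first)
        ; right-half     = λ B+D≡2 → ⊥-elim (>⇒≢ 3≤B+D B+D≡2)
        ; right-long     = λ _ → 3≤last , λ 1≤A →
                             subst (λ n → 6 ≤ deg E (suc b) + n) (sym first)
                                   (+-mono-≤ (proj₁ (left-pos 1≤A)) (+-monoˡ-≤ 1 (proj₂ (left-pos 1≤A))))
        ; interiorL      = interiorL
        ; interiorR-half = λ B+D≡2 → ⊥-elim (>⇒≢ 3≤B+D B+D≡2)
        ; interiorR-long = λ _ → interior-mediant
        }
        where
        3≤last : 3 ≤ deg joined (suc b + suc d)
        3≤last = subst (3 ≤_) (sym last) (+-monoˡ-≤ 1 (proj₁ right-ends))
        2≤last : 2 ≤ deg joined (suc b + suc d)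
        2≤last = ≤-trans (n≤1+n 2) 3≤last
        left-neighbours : suc b * (A + C) ≡ suc (A * (suc b + suc d))
        left-neighbours = begin
          suc b * (A + C)                ≡⟨ *-distribˡ-+ (suc b) A C ⟩
          suc b * A + suc b * C          ≡⟨ cong (suc b * A +_) neighbours ⟩
          suc b * A + suc (A * suc d)    ≡⟨ +-suc (suc b * A) (A * suc d) ⟩
          suc (suc b * A + A * suc d)    ≡⟨ cong (λ n → suc (n + A * suc d)) (*-comm (suc b) A) ⟩
          suc (A * suc b + A * suc d)    ≡⟨ cong suc (*-distribˡ-+ A (suc b) (suc d)) ⟨
          suc (A * (suc b + suc d))      ∎

      step-right : Weights.α weights < Weights.β weights →
                   Invariant f (A + C) (suc b + suc d) C (suc d) joined E'
      step-right α<β = record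
        { weights        = weights-right weights α<β
        ; neighbours     = right-neighbours
        ; 1≤B            = s≤s z≤n
        ; 2≤D            = 2≤D
        ; nodesL         = joinEdges-nodesBelow (suc b) (suc d) nodesL nodesR
        ; nodesR         = nodesR
        ; left-zero      = λ A+C≡0 → ⊥-elim (>⇒≢ (0<C {A} {suc b} {C} {suc d} neighbours) (m+n≡0⇒n≡0 A A+C≡0))
        ; left-pos       = λ _ → subst (3 ≤_) (sym last) (+-monoˡ-≤ 1 (proj₁ right-ends)) ,
                                 subst (2 ≤_) (sym first) (+-monoˡ-≤ 1 1≤first)
        ; right-ends     = right-ends
        ; right-half     = λ D≡2 → let (first-right , last-right , C≡1 , _) = right-half D≡2 in
                             first-right , last-right , C≡1 ,
                             λ _ → trans last (cong (_+ 1) last-right) , half-mediant-bound D≡2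
        ; right-long     = λ 3≤D → proj₁ (right-long 3≤D) , λ _ →
                             subst (λ n → 6 ≤ n + deg E' 0) (sym last)
                                   (+-mono-≤ (+-monoˡ-≤ 1 (proj₁ (right-long 3≤D))) (proj₂ right-ends))
        ; interiorL      = interior-mediant
        ; interiorR-half = interiorR-half
        ; interiorR-long = interiorR-long
        }
        where
        right-neighbours : (suc b + suc d) * C ≡ suc ((A + C) * suc d)
        right-neighbours = begin
          (suc b + suc d) * C            ≡⟨ *-distribʳ-+ C (suc b) (suc d) ⟩
          suc b * C + suc d * C          ≡⟨ cong (_+ suc d * C) neighbours ⟩
          suc (A * suc d + suc d * C)    ≡⟨ cong (λ n → suc (A * suc d + n)) (*-comm (suc d) C) ⟩
          suc (A * suc d + C * suc d)    ≡⟨ cong suc (*-distribʳ-+ (suc d) A C) ⟨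
          suc ((A + C) * suc d)          ∎
        half-mediant-bound : suc d ≡ 2 → suc b + suc d ≤ 3 * (A + C)
        half-mediant-bound D≡2 with zero-or-pos A
        ... | inj₁ A≡0 = ≤-reflexive (begin
          suc b + suc d  ≡⟨ cong₂ _+_ (m*n≡1⇒m≡1 (suc b) C (unimodular-at-zero A≡0)) D≡2 ⟩
          3              ≡⟨ cong (3 *_) (cong₂ _+_ A≡0 (proj₁ (proj₂ (proj₂ (right-half D≡2))))) ⟨
          3 * (A + C)    ∎)
        ... | inj₂ 1≤A = subst (suc b + suc d ≤_) (half-3[A+C] D≡2)
                           (+-mono-≤ (proj₂ (proj₂ (proj₂ (proj₂ (right-half D≡2))) 1≤A)) (≤-trans (≤-reflexive D≡2) (n≤1+n 2)))

      boundary-≥ : ∀ {x y} → x ≤ deg E 0 → y ≤ deg E' (suc d) →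
                   x + 1 + (y + 1) ≤ deg joined 0 + deg joined (suc b + suc d)
      boundary-≥ x≤ y≤ = subst₂ (λ m n → _ ≤ m + n) (sym first) (sym last)
                                (+-mono-≤ (+-monoˡ-≤ 1 x≤) (+-monoˡ-≤ 1 y≤))

      boundary≢5 : p ≡ A + C → Q ≡ suc b + suc d → deg joined 0 + deg joined (suc b + suc d) ≢ 5
      boundary≢5 p≡ Q≡ with zero-or-pos A | two-or-more 2≤D
      ... | inj₂ 1≤A | _        = >⇒≢ (boundary-≥ (proj₂ (left-pos 1≤A)) (proj₁ right-ends))
      ... | inj₁ _   | inj₂ 3≤D = >⇒≢ (boundary-≥ 1≤first (proj₁ (right-long 3≤D)))
      ... | inj₁ A≡0 | inj₁ D≡2 = λ _ → 3p≢Q (begin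
          3 * p            ≡⟨ cong (3 *_) (trans p≡ (cong₂ _+_ A≡0 (m*n≡1⇒n≡1 (suc b) C (unimodular-at-zero A≡0)))) ⟩
          3                ≡⟨ cong₂ _+_ (m*n≡1⇒m≡1 (suc b) C (unimodular-at-zero A≡0)) D≡2 ⟨
          suc b + suc d    ≡⟨ Q≡ ⟨
          Q                ∎)

      target-count : Weights.α weights ≡ Weights.β weights → count 5 Q joined ≡ 3 * p ∸ Q
      target-count α≡β = begin
        count 5 Q joined
          ≡⟨ cong (λ q → count 5 q joined) Q≡ ⟩
        count 5 (suc b + suc d) joined
          ≡⟨ count-interior 5 (suc b + suc d) joined ⟩
        indicator (deg joined 0 + deg joined (suc b + suc d) ≡ᵇ 5) + interior 5 joined (b + suc d)
          ≡⟨ cong₂ _+_ (cong indicator (≡ᵇ-false (boundary≢5 p≡ Q≡))) interior-mediant ⟩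
        3 * (A + C) ∸ (suc b + suc d)
          ≡⟨ cong₂ (λ x y → 3 * x ∸ y) p≡ Q≡ ⟨
        3 * p ∸ Q ∎
        where
        p≡ = proj₁ (weights-at weights α≡β)
        Q≡ = proj₂ (weights-at weights α≡β)

    descend-count : ∀ f A B C D E E' → Invariant f A B C D E E' →
                    count 5 Q (proj₂ (descend f p Q A B C D (suc B , E) (suc D , E'))) ≡ 3 * p ∸ Q
    descend-count f A zero C D E E' inv with Invariant.1≤B inv
    ... | ()
    descend-count f A (suc b) C zero E E' inv with Invariant.2≤D inv
    ... | ()
    descend-count zero A (suc b) C (suc d) E E' inv =
      ⊥-elim (weights-fuel≢0 (Invariant.weights inv) refl)
    descend-count (suc f) A (suc b) C (suc d) E E' inv
      with <-cmp (Weights.β (Invariant.weights inv)) (Weights.α (Invariant.weights inv))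
    ... | tri≈ _ β≡α _ = begin
        count 5 Q (proj₂ (descend (suc f) p Q A (suc b) C (suc d) G-left G-right))
          ≡⟨ cong (count 5 Q ∘ proj₂) (descend-at f p Q A (suc b) C (suc d) G-left G-right
                                         (at-mediant weights neighbours (sym β≡α))) ⟩
        count 5 Q (proj₂ (G-left ⊕ G-right))
          ≡⟨ cong (count 5 Q ∘ proj₂) ⊕-mediant ⟩
        count 5 Q joined
          ≡⟨ target-count (sym β≡α) ⟩
        3 * p ∸ Q ∎
      where
      open Invariant inv
      open Step inv
    ... | tri< β<α _ _ = begin
        count 5 Q (proj₂ (descend (suc f) p Q A (suc b) C (suc d) G-left G-right))
          ≡⟨ cong (count 5 Q ∘ proj₂) (descend-below f p Q A (suc b) C (suc d) G-left G-right
                                         (below-mediant weights neighbours β<α)) ⟩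
        count 5 Q (proj₂ (descend f p Q A (suc b) (A + C) (suc b + suc d) G-left (G-left ⊕ G-right)))
          ≡⟨ cong (λ G → count 5 Q (proj₂ (descend f p Q A (suc b) (A + C) (suc b + suc d) G-left G))) ⊕-mediant ⟩
        count 5 Q (proj₂ (descend f p Q A (suc b) (A + C) (suc b + suc d) G-left G-mediant))
          ≡⟨ descend-count f A (suc b) (A + C) (suc b + suc d) E joined (step-left β<α) ⟩
        3 * p ∸ Q ∎
      where
      open Invariant inv
      open Step inv
    ... | tri> _ _ α<β = begin
        count 5 Q (proj₂ (descend (suc f) p Q A (suc b) C (suc d) G-left G-right))
          ≡⟨ cong (count 5 Q ∘ proj₂) (descend-above f p Q A (suc b) C (suc d) G-left G-right
                                         (above-mediant weights neighbours α<β)) ⟩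
        count 5 Q (proj₂ (descend f p Q (A + C) (suc b + suc d) C (suc d) (G-left ⊕ G-right) G-right))
          ≡⟨ cong (λ G → count 5 Q (proj₂ (descend f p Q (A + C) (suc b + suc d) C (suc d) G G-right))) ⊕-mediant ⟩
        count 5 Q (proj₂ (descend f p Q (A + C) (suc b + suc d) C (suc d) G-mediant G-right))
          ≡⟨ descend-count f (A + C) (suc b + suc d) C (suc d) joined E' (step-right α<β) ⟩
        3 * p ∸ Q ∎
      where
      open Invariant inv
      open Step inv

    initial : ∀ f → 0 < p → 2 * p < Q → Q ≤ suc f →
              Invariant f 0 1 1 2 ((0 , 1) ∷ []) ((0 , 1) ∷ (1 , 2) ∷ (0 , 2) ∷ [])
    initial f 0<p 2p<Q Q≤f = record
      { weights        = record
        { α = Q ∸ 2 * p ; β = p ; 1≤α = m<n⇒0<n∸m 2p<Q ; 1≤β = 0<p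
        ; Q≡ = trans (cong₂ _+_ (*-identityʳ (Q ∸ 2 * p)) (*-comm p 2)) (m∸n+n≡m (<⇒≤ 2p<Q))
        ; p≡ = cong₂ _+_ (*-zeroʳ (Q ∸ 2 * p)) (*-identityʳ p)
        ; fuel = ≤-trans (≤-trans (+-monoʳ-≤ (Q ∸ 2 * p) (m≤n*m p 2)) (≤-reflexive (m∸n+n≡m (<⇒≤ 2p<Q)))) Q≤f
        }
      ; neighbours     = refl
      ; 1≤B            = s≤s z≤n
      ; 2≤D            = s≤s (s≤s z≤n)
      ; nodesL         = (z<s , s<s z<s) ∷ []
      ; nodesR         = (z<s , s<s z<s) ∷ (s<s z<s , s<s (s<s z<s)) ∷ (z<s , s<s (s<s z<s)) ∷ []
      ; left-zero      = λ _ → refl , refl , refl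
      ; left-pos       = λ ()
      ; right-ends     = s≤s (s≤s z≤n) , s≤s (s≤s z≤n)
      ; right-half     = λ _ → refl , refl , refl , λ ()
      ; right-long     = λ { (s≤s (s≤s ())) }
      ; interiorL      = refl
      ; interiorR-half = λ _ → refl
      ; interiorR-long = λ { (s≤s (s≤s ())) }
      }

  count5-haros : ∀ p Q → 0 < p → 2 * p < Q → Coprime p Q → 3 * p ≢ Q →
                 count 5 Q (proj₂ (haros p Q)) ≡ 3 * p ∸ Q
  count5-haros p (suc f) 0<p 2p<Q coprime 3p≢Q rewrite haros-first-step p f 0<p 2p<Q =
    descend-count f 0 1 1 2 _ _ (initial f 0<p 2p<Q ≤-refl)
    where open Target p (suc f) coprime 3p≢Q

open import Data.Product using (_×_)
open import Data.Rational using (ℚ; _≤_; _<_; 0ℚ; 1ℚ; ½)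
open import Relation.Binary.PropositionalEquality using (_≡_)

open import Data.Nat.Base as ℕ using (ℕ; suc)
import Data.Nat.Properties as ℕ
open import Data.Nat.Coprimality as Coprimality using (Coprime)
open import Data.Integer.Base using (+_; -[1+_]; +<+)
import Data.Integer.Properties as ℤ
open import Data.Rational using (mkℚ; _/_; *≤*; *<*)
open import Data.Rational.Properties using (normalize-coprime; 0/n≡0)
open import Data.Product using (_,_; proj₂)
open import Relation.Binary.PropositionalEquality using (_≢_; sym; trans; cong; subst; subst₂; module ≡-Reasoning)
open ≡-Reasoning
open Descent using (count5-haros)

coprime-+ˡ : ∀ {n q} → Coprime n q → Coprime n (q ℕ.+ n)
coprime-+ˡ {n} {q} c = subst (Coprime n) (ℕ.+-comm n q) (Coprimality.sym (Coprimality.coprime-+ (Coprimality.sym c)))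

F-mkℚ : ∀ n d-1 .(c : Coprime n (suc d-1)) →
        F (mkℚ (+ n) d-1 c) ≡ mkℚ (+ n) (d-1 ℕ.+ n) (coprime-+ˡ (Coprimality.recompute c))
F-mkℚ n d-1 c = normalize-coprime (coprime-+ˡ (Coprimality.recompute c))

P5∘F : ∀ n d-1 .(c : Coprime n (suc d-1)) → 0 ℕ.< n → n ℕ.< suc d-1 → 2 ℕ.* n ≢ suc d-1 →
       P 5 (F (mkℚ (+ n) d-1 c)) ≡ + (2 ℕ.* n ℕ.∸ suc d-1) / (suc d-1 ℕ.+ n)
P5∘F n d-1 c 0<n n<q 2n≢q =
  trans (cong (P 5) (F-mkℚ n d-1 c))
        (cong (λ k → + k / Q) (begin
          count 5 Q (proj₂ (haros n Q))  ≡⟨ count5-haros n Q 0<n 2n<Q (coprime-+ˡ (Coprimality.recompute c)) 3n≢Q ⟩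
          3 ℕ.* n ℕ.∸ (q ℕ.+ n)          ≡⟨ cong (3 ℕ.* n ℕ.∸_) (ℕ.+-comm q n) ⟩
          (n ℕ.+ 2 ℕ.* n) ℕ.∸ (n ℕ.+ q)  ≡⟨ ℕ.[m+n]∸[m+o]≡n∸o n (2 ℕ.* n) q ⟩
          2 ℕ.* n ℕ.∸ q                  ∎))
  where
  q Q : ℕ
  q = suc d-1
  Q = q ℕ.+ n
  2n<Q : 2 ℕ.* n ℕ.< Q
  2n<Q = subst (ℕ._< Q) (cong (n ℕ.+_) (sym (ℕ.+-identityʳ n))) (ℕ.+-monoˡ-< n n<q)
  3n≢Q : 3 ℕ.* n ≢ Q
  3n≢Q eq = 2n≢q (ℕ.+-cancelˡ-≡ n _ _ (trans eq (ℕ.+-comm q n)))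

corollary12 : (x : ℚ) → 0ℚ ≤ x → x ≤ 1ℚ →
    ((x < ½ → P 5 (F x) ≡ 0ℚ) × (½ < x → x < 1ℚ → P 5 (F x) ≡ rhs x))
corollary12 (mkℚ -[1+ _ ] _ _) (*≤* ()) _
corollary12 (mkℚ (+ 0) d-1 _) _ _ = (λ _ → cong (P 5) (0/n≡0 (suc d-1 ℕ.+ 0))) , λ { (*<* (+<+ ())) _ }
corollary12 (mkℚ (+ suc m) d-1 c) _ _ = below-half , above-half
  where
  n q : ℕ
  n = suc m
  q = suc d-1
  below-half : mkℚ (+ n) d-1 c < ½ → P 5 (F (mkℚ (+ n) d-1 c)) ≡ 0ℚ
  below-half (*<* (+<+ 2n<q)) = begin
    P 5 (F (mkℚ (+ n) d-1 c))      ≡⟨ P5∘F n d-1 c ℕ.z<s (ℕ.≤-<-trans (ℕ.m≤n*m n 2) 2n<q′) (ℕ.<⇒≢ 2n<q′) ⟩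
    + (2 ℕ.* n ℕ.∸ q) / (q ℕ.+ n)  ≡⟨ cong (λ k → + k / (q ℕ.+ n)) (ℕ.m≤n⇒m∸n≡0 (ℕ.<⇒≤ 2n<q′)) ⟩
    + 0 / (q ℕ.+ n)                ≡⟨ 0/n≡0 (q ℕ.+ n) ⟩
    0ℚ                             ∎
    where
    2n<q′ : 2 ℕ.* n ℕ.< q
    2n<q′ = subst₂ ℕ._<_ (ℕ.*-comm n 2) (ℕ.*-identityˡ q) 2n<q
  above-half : ½ < mkℚ (+ n) d-1 c → mkℚ (+ n) d-1 c < 1ℚ → P 5 (F (mkℚ (+ n) d-1 c)) ≡ rhs (mkℚ (+ n) d-1 c)
  above-half (*<* (+<+ q<2n)) (*<* (+<+ n<q)) = begin
    P 5 (F (mkℚ (+ n) d-1 c))      ≡⟨ P5∘F n d-1 c ℕ.z<s n<q′ (ℕ.>⇒≢ q<2n′) ⟩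
    + (2 ℕ.* n ℕ.∸ q) / (q ℕ.+ n)  ≡⟨ cong (_/ (q ℕ.+ n)) (trans (ℤ.m-n≡m⊖n (2 ℕ.* n) q) (ℤ.⊖-≥ (ℕ.<⇒≤ q<2n′))) ⟨
    rhs (mkℚ (+ n) d-1 c)          ∎
    where
    q<2n′ : q ℕ.< 2 ℕ.* n
    q<2n′ = subst₂ ℕ._<_ (ℕ.*-identityˡ q) (ℕ.*-comm n 2) q<2n
    n<q′ : n ℕ.< q
    n<q′ = subst₂ ℕ._<_ (ℕ.*-identityʳ n) (ℕ.*-identityˡ q) n<q
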